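{- Let $b\ge 2$ and $k\ge 1$ be integers, and set $B=b^k$. Let $m\ge 1$ be an integer with $\gcd(m,b)=1$, and let $r$ be an integer with $0\le r<m$. Then there exist infinitely many positive integers $n$ with $n\equiv r \pmod m$ such that \[ \mathsf{s}_b(n)\mid n \quad\text{and}\quad \mathsf{s}_B(n)\mid n. \] Moreover, for any $s_0\ge 1$, there exists such an $n$ (positive, $n\equiv r\pmod m$, with $\mathsf{s}_b(n)\mid n$ and $\mathsf{s}_B(n)\mid n$) with $\mathsf{s}_b(n)=\mathsf{s}_B(n)\ge s_0$.
   Context: For an integer base $g\ge 2$ and a positive integer $c$ with base-$g$ expansion $c=\sum_{i=0}^{L} d_i g^i$, $d_i\in\{0,1,\dots,g-1\}$, $d_L\neq 0$, the base-$g$ digit sum is $\mathsf{s}_g(c)=\sum_{i=0}^{L} d_i$ (with $\mathsf{s}_g(0)=0$). An integer $c$ is called $g$-Niven if $\mathsf{s}_g(c)\mid c$. -}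

module Defs where

open import Data.Nat using (ℕ; zero; suc; _+_; _/_; _%_; _≥_)

-- Base-g digit sum with a fuel parameter; fuel ≥ c suffices since each step
-- (for g ≥ 2) strictly decreases c. Base-2-or-larger is assumed by callers.
digitSumAux : (fuel g : ℕ) → .{{_ : Data.Nat.NonZero g}} → ℕ → ℕ
digitSumAux zero    g c = 0
digitSumAux (suc f) g zero = 0
digitSumAux (suc f) g c@(suc _) = c % g + digitSumAux f g (c / g)

digitSum : (g : ℕ) → .{{_ : Data.Nat.NonZero g}} → ℕ → ℕ
digitSum g c = digitSumAux c g c

-- Digit sum for an arbitrary base argument g; agrees with digitSum g when g ≥ 1
-- (the theorem only uses it with g ≥ 2). s g c = s_g(c).
s : ℕ → ℕ → ℕ
s g c = digitSum (suc (g Data.Nat.∸ 1)) c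

-- n mod m, for m ≥ 1 (the theorem only uses it with m ≥ 1).
_mod_ : ℕ → ℕ → ℕ
n mod m = n % suc (m Data.Nat.∸ 1)

-- Choose t ≥ s₀ with t ≡ r (mod m) and t ≡ 1 (mod b), and an exponent P with
-- (b^k)^P ≡ 1 (mod tm), which exists because tm is coprime to b. The number
-- n = 1 + Q + ⋯ + Q^(t−1) with Q = (b^k)^P is written with t digits 1 both in
-- base b and in base b^k, so both digit sums equal t; and n ≡ t (mod tm) gives
-- t ∣ n and n ≡ r (mod m).
module Submission where

open import Data.Nat
open import Data.Nat.Properties
open import Data.Nat.DivMod hiding (_mod_)
open import Data.Nat.Divisibility
open import Data.Nat.Coprimality as Coprimality using (Coprime; coprime-divisor; gcd≡1⇒coprime)
open import Data.Nat.GCD using (gcd)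
open import Data.Nat.Tactic.RingSolver using (solve-∀)
open import Data.Fin using (toℕ; fromℕ<)
open import Data.Fin.Properties using (pigeonhole; toℕ-fromℕ<)
open import Data.Product using (_×_; _,_; ∃-syntax)
open import Relation.Binary.PropositionalEquality
open ≡-Reasoning

open import Defs

module _ {g : ℕ} .{{_ : NonZero g}} (1<g : 1 < g) where

  private
    /-pred : ∀ {c f} → suc c ≤ suc f → suc c / g ≤ f
    /-pred c≤f = s≤s⁻¹ (≤-trans (m/n<m _ g 1<g) c≤f)

  digitSumAux-zero : ∀ f → digitSumAux f g 0 ≡ 0
  digitSumAux-zero zero    = refl
  digitSumAux-zero (suc f) = refl

  digitSumAux-fuel : ∀ {f f′} c → c ≤ f → c ≤ f′ → digitSumAux f g c ≡ digitSumAux f′ g c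
  digitSumAux-fuel {f} {f′} zero _ _ = trans (digitSumAux-zero f) (sym (digitSumAux-zero f′))
  digitSumAux-fuel {suc f} {suc f′} c@(suc _) c≤f c≤f′ =
    cong (c % g +_) (digitSumAux-fuel (c / g) (/-pred c≤f) (/-pred c≤f′))

  digitSum-unfold : ∀ c → digitSum g c ≡ c % g + digitSum g (c / g)
  digitSum-unfold zero = sym (cong₂ _+_ (m<n⇒m%n≡m 0<g) (cong (digitSum g) (0/n≡0 g)))
    where
    0<g : 0 < g
    0<g = <-trans z<s 1<g
  digitSum-unfold c@(suc _) = cong (c % g +_) (digitSumAux-fuel (c / g) (/-pred ≤-refl) ≤-refl)

  digitSum-+* : ∀ {d} c → d < g → digitSum g (d + c * g) ≡ d + digitSum g c
  digitSum-+* {d} c d<g = begin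
    digitSum g (d + c * g)                      ≡⟨ digitSum-unfold (d + c * g) ⟩
    (d + c * g) % g + digitSum g ((d + c * g) / g)
      ≡⟨ cong₂ (λ x y → x + digitSum g y) lowDigit highDigits ⟩
    d + digitSum g c                            ∎
    where
    lowDigit : (d + c * g) % g ≡ d
    lowDigit = trans ([m+kn]%n≡m%n d c g) (m<n⇒m%n≡m d<g)
    highDigits : (d + c * g) / g ≡ c
    highDigits = trans (+-distrib-/-∣ʳ d (n∣m*n c)) (cong₂ _+_ (m<n⇒m/n≡0 d<g) (m*n/n≡m c g))

  digitSum-^* : ∀ j x → digitSum g (g ^ j * x) ≡ digitSum g x
  digitSum-^* zero    x = cong (digitSum g) (+-identityʳ x)
  digitSum-^* (suc j) x = begin
    digitSum g (g * g ^ j * x) ≡⟨ cong (digitSum g) (trans (*-assoc g (g ^ j) x) (*-comm g (g ^ j * x))) ⟩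
    digitSum g (g ^ j * x * g) ≡⟨ digitSum-+* (g ^ j * x) (<-trans z<s 1<g) ⟩
    digitSum g (g ^ j * x)     ≡⟨ digitSum-^* j x ⟩
    digitSum g x               ∎

  digitSum-1+^* : ∀ e x → digitSum g (1 + g ^ suc e * x) ≡ 1 + digitSum g x
  digitSum-1+^* e x = begin
    digitSum g (1 + g * g ^ e * x) ≡⟨ cong (λ y → digitSum g (1 + y)) (trans (*-assoc g (g ^ e) x) (*-comm g (g ^ e * x))) ⟩
    digitSum g (1 + g ^ e * x * g) ≡⟨ digitSum-+* (g ^ e * x) 1<g ⟩
    1 + digitSum g (g ^ e * x)     ≡⟨ cong suc (digitSum-^* e x) ⟩
    1 + digitSum g x               ∎

repunit : ℕ → ℕ → ℕ
repunit Q zero    = 0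
repunit Q (suc t) = 1 + Q * repunit Q t

digitSum-repunit : ∀ {g} .{{_ : NonZero g}} → 1 < g → ∀ e t → digitSum g (repunit (g ^ suc e) t) ≡ t
digitSum-repunit 1<g e zero    = refl
digitSum-repunit 1<g e (suc t) = trans (digitSum-1+^* 1<g e _) (cong suc (digitSum-repunit 1<g e t))

s-repunit : ∀ {g} → 1 < g → ∀ e t → s g (repunit (g ^ suc e) t) ≡ t
s-repunit {suc _} = digitSum-repunit

repunit-≡-length-mod : ∀ {Q M e} → Q ≡ 1 + M * e → ∀ t → ∃[ q ] repunit Q t ≡ t + M * q
repunit-≡-length-mod {M = M} _ zero = 0 , sym (*-zeroʳ M)
repunit-≡-length-mod {Q} {M} {e} Q≡1+Me (suc t) with repunit-≡-length-mod {Q} {M} {e} Q≡1+Me t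
... | q , eq = q + e * (t + M * q) , (begin
  1 + Q * repunit Q t            ≡⟨ cong₂ (λ u v → 1 + u * v) Q≡1+Me eq ⟩
  1 + (1 + M * e) * (t + M * q) ≡⟨ expand M e t q ⟩
  suc t + M * (q + e * (t + M * q)) ∎)
  where
  expand : ∀ M e t q → 1 + (1 + M * e) * (t + M * q) ≡ suc t + M * (q + e * (t + M * q))
  expand = solve-∀

Coprime-∣ˡ : ∀ {i x y} → i ∣ x → Coprime x y → Coprime i y
Coprime-∣ˡ i∣x cop (j∣i , j∣y) = cop (∣-trans j∣i i∣x , j∣y)

Coprime-*ˡ : ∀ {x y b} → Coprime x b → Coprime y b → Coprime (x * y) b
Coprime-*ˡ {x} {y} cx cy {i} (i∣xy , i∣b) =
  cx (coprime-divisor (Coprime-∣ˡ i∣b (Coprimality.sym cy)) (subst (i ∣_) (*-comm x y) i∣xy) , i∣b)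

Coprime-^ʳ : ∀ {x b} → Coprime x b → ∀ n → Coprime x (b ^ n)
Coprime-^ʳ cop zero    (_   , i∣1)   = ∣1⇒≡1 i∣1
Coprime-^ʳ cop (suc n) (i∣x , i∣bbⁿ) = Coprime-^ʳ cop n (i∣x , coprime-divisor (Coprime-∣ˡ i∣x cop) i∣bbⁿ)

Coprime-1+* : ∀ b β → Coprime (1 + b * β) b
Coprime-1+* b β {i} (i∣1+bβ , i∣b) = ∣1⇒≡1 (∣m+n∣m⇒∣n (subst (i ∣_) (+-comm 1 (b * β)) i∣1+bβ) (∣m⇒∣m*n β i∣b))

coprime-divisor-^ : ∀ {M a} → Coprime M a → ∀ n {x} → M ∣ a ^ n * x → M ∣ x
coprime-divisor-^ cop zero    {x} M∣aⁿx = subst (_ ∣_) (+-identityʳ x) M∣aⁿx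
coprime-divisor-^ {M} {a} cop (suc n) {x} M∣aⁿx =
  coprime-divisor-^ cop n (coprime-divisor cop (subst (M ∣_) (*-assoc a (a ^ n) x) M∣aⁿx))

%≡%⇒∣∸ : ∀ {x y} M .{{_ : NonZero M}} → x % M ≡ y % M → M ∣ y ∸ x
%≡%⇒∣∸ {x} {y} M x%M≡y%M = divides (y / M ∸ x / M) (begin
  y ∸ x                                     ≡⟨ cong₂ _∸_ (m≡m%n+[m/n]*n y M) (m≡m%n+[m/n]*n x M) ⟩
  (y % M + y / M * M) ∸ (x % M + x / M * M) ≡⟨ cong (λ z → (z + y / M * M) ∸ (x % M + x / M * M)) (sym x%M≡y%M) ⟩
  (x % M + y / M * M) ∸ (x % M + x / M * M) ≡⟨ [m+n]∸[m+o]≡n∸o (x % M) _ _ ⟩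
  y / M * M ∸ x / M * M                     ≡⟨ *-distribʳ-∸ M (y / M) (x / M) ⟨
  (y / M ∸ x / M) * M                       ∎)

^-%-collision : ∀ a M .{{_ : NonZero M}} → ∃[ i ] ∃[ d ] a ^ i % M ≡ a ^ (i + suc d) % M
^-%-collision a M with pigeonhole (n<1+n M) (λ i → fromℕ< (m%n<n (a ^ toℕ i) M))
... | i , j , i<j , eq with m≤n⇒∃[o]m+o≡n i<j
... | d , 1+i+d≡j = toℕ i , d , (begin
  a ^ toℕ i % M                        ≡⟨ toℕ-fromℕ< (m%n<n (a ^ toℕ i) M) ⟨
  toℕ (fromℕ< (m%n<n (a ^ toℕ i) M))   ≡⟨ cong toℕ eq ⟩
  toℕ (fromℕ< (m%n<n (a ^ toℕ j) M))   ≡⟨ toℕ-fromℕ< (m%n<n (a ^ toℕ j) M) ⟩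
  a ^ toℕ j % M                        ≡⟨ cong (λ x → a ^ x % M) (trans (+-suc (toℕ i) d) 1+i+d≡j) ⟨
  a ^ (toℕ i + suc d) % M              ∎)

^≡1-mod : ∀ {M a} .{{_ : NonZero M}} .{{_ : NonZero a}} → Coprime M a → ∃[ d ] ∃[ e ] a ^ suc d ≡ 1 + M * e
^≡1-mod {M} {a} cop with ^-%-collision a M
... | i , d , eq = d , (a ^ suc d ∸ 1) / M , (begin
  a ^ suc d                     ≡⟨ m+[n∸m]≡n (m^n>0 a (suc d)) ⟨
  1 + (a ^ suc d ∸ 1)           ≡⟨ cong (1 +_) (m*[n/m]≡n M∣aᵈ⁺¹∸1) ⟨
  1 + M * ((a ^ suc d ∸ 1) / M) ∎)
  where
  M∣aᵈ⁺¹∸1 : M ∣ a ^ suc d ∸ 1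
  M∣aᵈ⁺¹∸1 = coprime-divisor-^ cop i (subst (M ∣_) (begin
    a ^ (i + suc d) ∸ a ^ i       ≡⟨ cong₂ _∸_ (^-distribˡ-+-* a i (suc d)) (sym (*-identityʳ (a ^ i))) ⟩
    a ^ i * a ^ suc d ∸ a ^ i * 1 ≡⟨ *-distribˡ-∸ (a ^ i) (a ^ suc d) 1 ⟨
    a ^ i * (a ^ suc d ∸ 1)       ∎) (%≡%⇒∣∸ M eq))

∃-coprime-in-residue-class : ∀ {b m} .{{_ : NonZero b}} .{{_ : NonZero m}} → Coprime m b → ∀ r s₀ →
  ∃[ t ] ∃[ α ] (t ≡ r + m * α × Coprime t b × s₀ ≤ t)
∃-coprime-in-residue-class {b@(suc b′)} {m} cop r s₀ with ^≡1-mod (Coprimality.sym cop)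
... | d , w , mᵈ⁺¹≡1+bw = r + m * (m ^ d * c) , m ^ d * c , refl ,
  subst (λ t → Coprime t b) (sym t≡1+bβ) (Coprime-1+* b β) ,
  subst (s₀ ≤_) (sym t≡1+bβ) (m≤n⇒m≤1+n (≤-trans s₀≤β (m≤n*m β b)))
  where
  -- t = r + m^(d+1) c ≡ r + c ≡ 1 (mod b) since c ≡ 1 − r; the summand b s₀ makes t ≥ s₀.
  c : ℕ
  c = 1 + b′ * r + b * s₀
  β : ℕ
  β = r + s₀ + w * c
  rearrange : ∀ b′ r s₀ w → r + (1 + suc b′ * w) * (1 + b′ * r + suc b′ * s₀) ≡
    1 + suc b′ * (r + s₀ + w * (1 + b′ * r + suc b′ * s₀))
  rearrange = solve-∀
  t≡1+bβ : r + m * (m ^ d * c) ≡ 1 + b * β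
  t≡1+bβ = begin
    r + m * (m ^ d * c)  ≡⟨ cong (r +_) (*-assoc m (m ^ d) c) ⟨
    r + m ^ suc d * c    ≡⟨ cong (λ u → r + u * c) mᵈ⁺¹≡1+bw ⟩
    r + (1 + b * w) * c  ≡⟨ rearrange b′ r s₀ w ⟩
    1 + b * β            ∎
  s₀≤β : s₀ ≤ β
  s₀≤β = ≤-trans (m≤n+m s₀ r) (m≤m+n (r + s₀) (w * c))

∃-repunit-with-digitSums : ∀ {b t m} k → 1 < b → .{{_ : NonZero t}} .{{_ : NonZero m}} → Coprime (t * m) b →
  ∃[ n ] ∃[ q ] (n ≡ t + t * m * q × s b n ≡ t × s (b ^ suc k) n ≡ t)
∃-repunit-with-digitSums {b@(suc _)} {t} {m} k 1<b cop
  with ^≡1-mod {t * m} {b ^ suc k} {{m*n≢0 t m}} {{m^n≢0 b (suc k)}} (Coprime-^ʳ cop (suc k))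
... | p , e , Bᵖ⁺¹≡1+tme with repunit-≡-length-mod {M = t * m} Bᵖ⁺¹≡1+tme t
... | q , n≡t+tmq = repunit (B ^ suc p) t , q , n≡t+tmq , s-base , s-power
  where
  B : ℕ
  B = b ^ suc k
  s-base : s b (repunit (B ^ suc p) t) ≡ t
  s-base = trans (cong (λ Q → s b (repunit Q t)) (^-*-assoc b (suc k) (suc p))) (s-repunit 1<b (p + k * suc p) t)
  s-power : s B (repunit (B ^ suc p) t) ≡ t
  s-power = s-repunit {B} (^-monoʳ-< b 1<b {0} {suc k} z<s) p t

digitSums≡t⇒Niven-pair : ∀ {b B m r t α s₀} n q → 1 ≤ m → r < m → t ≡ r + m * α → s₀ ≤ t →
  n ≡ t + t * m * q → s b n ≡ t → s B n ≡ t →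
  n mod m ≡ r × s b n ∣ n × s B n ∣ n × s b n ≡ s B n × s₀ ≤ s b n × s b n ≤ n
digitSums≡t⇒Niven-pair {b} {B} {m@(suc _)} {r} {t} {α} {s₀} n q _ r<m t≡r+mα s₀≤t n≡t+tmq sbn≡t sBn≡t =
  n%m≡r , subst (_∣ n) (sym sbn≡t) t∣n , subst (_∣ n) (sym sBn≡t) t∣n ,
  trans sbn≡t (sym sBn≡t) , subst (s₀ ≤_) (sym sbn≡t) s₀≤t , subst (_≤ n) (sym sbn≡t) t≤n
  where
  regroup : ∀ r m α t q → r + m * α + t * m * q ≡ r + (α + t * q) * m
  regroup = solve-∀
  t∣n : t ∣ n
  t∣n = subst (t ∣_) (sym n≡t+tmq) (∣m∣n⇒∣m+n ∣-refl (∣-trans (m∣m*n m) (m∣m*n q)))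
  t≤n : t ≤ n
  t≤n = subst (t ≤_) (sym n≡t+tmq) (m≤m+n t (t * m * q))
  n%m≡r : n % m ≡ r
  n%m≡r = begin
    n % m                       ≡⟨ cong (_% m) n≡t+tmq ⟩
    (t + t * m * q) % m         ≡⟨ cong (λ u → (u + t * m * q) % m) t≡r+mα ⟩
    (r + m * α + t * m * q) % m ≡⟨ cong (_% m) (regroup r m α t q) ⟩
    (r + (α + t * q) * m) % m   ≡⟨ [m+kn]%n≡m%n r (α + t * q) m ⟩
    r % m                       ≡⟨ m<n⇒m%n≡m r<m ⟩
    r                           ∎

∃-b-and-b^k-Niven : ∀ {b k m r} → 1 < b → 1 ≤ k → 1 ≤ m → Coprime m b → r < m → ∀ {s₀} → 1 ≤ s₀ →
  ∃[ n ] (n mod m ≡ r × s b n ∣ n × s (b ^ k) n ∣ n × s b n ≡ s (b ^ k) n × s₀ ≤ s b n × s b n ≤ n)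
∃-b-and-b^k-Niven {b@(suc _)} {suc k} {m@(suc _)} {r} 1<b _ 1≤m cop r<m {s₀} 1≤s₀ =
  let t , α , t≡r+mα , cop-t , s₀≤t = ∃-coprime-in-residue-class cop r s₀
      n , q , n≡t+tmq , sbn≡t , sBn≡t =
        ∃-repunit-with-digitSums {t = t} {m} k 1<b {{>-nonZero (≤-trans 1≤s₀ s₀≤t)}} (Coprime-*ˡ cop-t cop)
  in n , digitSums≡t⇒Niven-pair {b} {b ^ suc k} n q 1≤m r<m t≡r+mα s₀≤t n≡t+tmq sbn≡t sBn≡t

theorem1p1 : (b k m r : ℕ) → 2 ≤ b → 1 ≤ k → 1 ≤ m → gcd m b ≡ 1 → r < m →
    ((N : ℕ) → ∃[ n ] (N < n × n mod m ≡ r × s b n ∣ n × s (b ^ k) n ∣ n))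
    × ((s₀ : ℕ) → 1 ≤ s₀ → ∃[ n ] (0 < n × n mod m ≡ r × s b n ∣ n × s (b ^ k) n ∣ n × s b n ≡ s (b ^ k) n × s₀ ≤ s b n))
theorem1p1 b k m r 1<b 1≤k 1≤m gcd≡1 r<m = infinitelyMany , largeDigitSum
  where
  cop : Coprime m b
  cop = gcd≡1⇒coprime gcd≡1

  infinitelyMany : (N : ℕ) → ∃[ n ] (N < n × n mod m ≡ r × s b n ∣ n × s (b ^ k) n ∣ n)
  infinitelyMany N with ∃-b-and-b^k-Niven 1<b 1≤k 1≤m cop r<m (s≤s (z≤n {N}))
  ... | n , n%m≡r , sb∣n , sB∣n , _ , N<sb , sb≤n = n , ≤-trans N<sb sb≤n , n%m≡r , sb∣n , sB∣n

  largeDigitSum : (s₀ : ℕ) → 1 ≤ s₀ →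
    ∃[ n ] (0 < n × n mod m ≡ r × s b n ∣ n × s (b ^ k) n ∣ n × s b n ≡ s (b ^ k) n × s₀ ≤ s b n)
  largeDigitSum s₀ 1≤s₀ with ∃-b-and-b^k-Niven 1<b 1≤k 1≤m cop r<m 1≤s₀
  ... | n , n%m≡r , sb∣n , sB∣n , sb≡sB , s₀≤sb , sb≤n =
    n , ≤-trans 1≤s₀ (≤-trans s₀≤sb sb≤n) , n%m≡r , sb∣n , sB∣n , sb≡sB , s₀≤sb
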